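{- For every $\epsilon>0$ and every $w\in\left[\frac12,1\right)$ there exist a graph $G$ and a configuration $C_0$ of $G$ such that the proportion of vertices of $G$ that are defectors in $C_0$ is less than $\epsilon$ and $C_0$ is defector dominant in the $w$-power index process.
   Context: All graphs are finite and simple. A configuration of a graph $G$ is a map $C:V(G)\to\{C,D\}$; vertices with value $C$ are collaborators, those with value $D$ defectors. $N[v]$ is the closed neighbourhood of $v$, $N_C[v]$ is the set of collaborators in $N[v]$ and $N_D[v]$ the set of defectors in $N[v]$. For a win condition $w\in\left[\frac12,1\right)$, the power of $v$ with respect to a configuration is: if $v$ is a collaborator, $p(v)=1/|N_C[v]|$ when $|N_C[v]|/|N[v]|>w$ and $p(v)=0$ otherwise; if $v$ is a defector, $p(v)=1/|N_D[v]|$ when $|N_C[v]|/|N[v]|\le w$ and $p(v)=0$ otherwise. The $w$-power index process with initial configuration $C_0$ produces configurations $C_1,C_2,\dots$: for $t\ge1$ each vertex $v$ simultaneously takes the strategy that, in $C_{t-1}$, is held by the vertex of $N[v]$ of greatest power (powers computed with respect to $C_{t-1}$); if the vertices of $N[v]$ of greatest power have differing strategies, then $C_t(v)=C_{t-1}(v)$. $C_0$ is defector dominant if there is $i\ge0$ with $C_i=C_{i+1}$ and $C_i(v)=D$ for every vertex $v$.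
   Formalization: The win condition w and the bound ε take only rational values. -}

module Defs where

open import Data.Nat using (ℕ; zero; suc)
open import Data.Integer using (+_)
open import Data.Rational using (ℚ; 0ℚ; _/_; _<_; _≤_; _⊔_; _≟_; _<?_)
open import Data.Bool using (Bool; true; false; _∨_; if_then_else_)
open import Data.Fin using (Fin)
import Data.Fin as F
open import Data.List using (List; filter; length; allFin; map; foldr; []; _∷_)
open import Data.Product using (Σ; ∃; _×_)
open import Relation.Binary.PropositionalEquality using (_≡_)
open import Relation.Nullary.Decidable using (⌊_⌋)
open import Relation.Nullary using (yes; no)
import Data.Bool

record Graph : Set where
  field
    n      : ℕ
    adj    : Fin n → Fin n → Bool
    sym    : ∀ u v → adj u v ≡ adj v u
    irrefl : ∀ v → adj v v ≡ false
open Graph public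

data Strategy : Set where
  C D : Strategy

isC : Strategy → Bool
isC C = true
isC D = false

isD : Strategy → Bool
isD C = false
isD D = true

Config : Graph → Set
Config G = Fin (n G) → Strategy

-- the rational a / b, with the (never used) convention a / 0 = 0
frac : ℕ → ℕ → ℚ
frac a zero    = 0ℚ
frac a (suc b) = (+ a) / suc b

N[_]_ : (G : Graph) → Fin (n G) → List (Fin (n G))
N[ G ] v = filter (λ u → ⌊ u F.≟ v ⌋ ∨ adj G v u Data.Bool.≟ true) (allFin (n G))

nC : (G : Graph) → Config G → Fin (n G) → ℕ
nC G c v = length (filter (λ u → isC (c u) Data.Bool.≟ true) (N[ G ] v))

nN : (G : Graph) → Fin (n G) → ℕ
nN G v = length (N[ G ] v)

nD : (G : Graph) → Config G → Fin (n G) → ℕ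
nD G c v = length (filter (λ u → isD (c u) Data.Bool.≟ true) (N[ G ] v))

power : ℚ → (G : Graph) → Config G → Fin (n G) → ℚ
power w G c v with c v | w <? frac (nC G c v) (nN G v)
... | C | yes _ = frac 1 (nC G c v)
... | C | no  _ = 0ℚ
... | D | yes _ = 0ℚ
... | D | no  _ = frac 1 (nD G c v)

allB : {A : Set} → (A → Bool) → List A → Bool
allB p []       = true
allB p (x ∷ xs) = if p x then allB p xs else false

step : ℚ → (G : Graph) → Config G → Config G
step w G c v =
  let nb   = N[ G ] v
      maxP = foldr _⊔_ 0ℚ (map (power w G c) nb)
      best = filter (λ u → power w G c u ≟ maxP) nb
  in if allB (λ u → isC (c u)) best then C
     else if allB (λ u → isD (c u)) best then D
     else c v

iterate : ℚ → (G : Graph) → Config G → ℕ → Config G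
iterate w G c zero    = c
iterate w G c (suc t) = step w G (iterate w G c t)

DefectorDominant : ℚ → (G : Graph) → Config G → Set
DefectorDominant w G c0 =
  ∃ λ i → (∀ v → iterate w G c0 i v ≡ iterate w G c0 (suc i) v)
        × (∀ v → iterate w G c0 i v ≡ D)

numD : (G : Graph) → Config G → ℕ
numD G c = length (filter (λ u → isD (c u) Data.Bool.≟ true) (allFin (n G)))

{-# OPTIONS --safe #-}
-- Take k ≥ 2 defectors and k² collaborators, each group a clique, and join the i-th defector
-- to the i-th block of k collaborators. A defector sees k defectors and k collaborators, so
-- for w ≥ ½ it is winning with power 1/k, while a collaborator sees all k² collaborators and
-- has power at most 1/k². Every vertex has a defector in its closed neighbourhood that beats
-- every collaborator there, so after one step everybody defects, and the all-defector
-- configuration is fixed. The defector proportion is k / (k + k²) = 1 / (k + 1).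
module Submission where

open import Defs hiding (sym)
open import Data.Nat using (NonZero)
open import Data.Rational using (ℚ; 0ℚ; ½; 1ℚ; _<_; _≤_)
open import Data.Product using (Σ; _×_)

open import Data.Bool as Bool using (Bool; true; false; not; _∧_; _∨_; if_then_else_)
open import Data.Bool.Properties using (∧-identityʳ; ∧-zeroʳ)
open import Data.Empty using (⊥-elim)
open import Data.Fin as Fin using (Fin; zero; suc; splitAt; quotient; _↑ˡ_)
open import Data.Fin.Properties using (splitAt-↑ˡ)
open import Data.Integer as ℤ using (+_; -[1+_]; +≤+; +<+)
import Data.Integer.Properties as ℤ
open import Data.List using (List; []; _∷_; filter; length; map; foldr; tabulate; allFin)
open import Data.List.Membership.Propositional using (_∈_)
open import Data.List.Membership.Propositional.Properties using (∈-filter⁺; ∈-filter⁻; ∈-allFin)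
open import Data.List.Relation.Unary.Any using (here; there)
open import Data.Nat as ℕ using (ℕ; zero; suc; _+_; _*_)
import Data.Nat.Properties as ℕ
open import Data.Nat.Tactic.RingSolver using (solve-∀)
open import Data.Product using (_,_; ∃; proj₁; proj₂; swap)
open import Data.Rational using (_⊔_; _<?_; mkℚ; toℚᵘ)
import Data.Rational as ℚ
import Data.Rational.Properties as ℚ
import Data.Rational.Unnormalised as ℚᵘ
import Data.Rational.Unnormalised.Properties as ℚᵘ
open import Data.Sum as Sum using (_⊎_; inj₁; inj₂; [_,_]′)
open import Data.Sum.Properties using ([,]-∘)
open import Function using (_∘_; id; const)
open import Relation.Binary.PropositionalEquality
open import Relation.Nullary using (yes; no)
open import Relation.Nullary.Decidable using (⌊_⌋; does; isYes≗does; dec-true; dec-false)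

count : ∀ {n} → (Fin n → Bool) → ℕ
count {zero}  p = 0
count {suc n} p = if p zero then suc (count (p ∘ suc)) else count (p ∘ suc)

count-cong : ∀ {n} {p q : Fin n → Bool} → (∀ i → p i ≡ q i) → count p ≡ count q
count-cong {zero}  p≗q = refl
count-cong {suc n} p≗q rewrite p≗q zero | count-cong (p≗q ∘ suc) = refl

count-const : ∀ n b → count {n} (const b) ≡ (if b then n else 0)
count-const zero    true  = refl
count-const zero    false = refl
count-const (suc n) true  = cong suc (count-const n true)
count-const (suc n) false = count-const n false

count-splitAt : ∀ m {n} (p : Fin m ⊎ Fin n → Bool) →
                count (p ∘ splitAt m) ≡ count (p ∘ inj₁) + count (p ∘ inj₂)
count-splitAt zero    p = refl
count-splitAt (suc m) p with p (inj₁ zero)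
... | true  = cong suc (count-splitAt m (p ∘ Sum.map₁ suc))
... | false = count-splitAt m (p ∘ Sum.map₁ suc)

quotient-splitAt : ∀ {m} n (i : Fin (suc m * n)) →
                   quotient n i ≡ [ const zero , suc ∘ quotient {m} n ]′ (splitAt n i)
quotient-splitAt n i = [,]-∘ (proj₁ ∘ swap) (splitAt n i)

count-quotient : ∀ m n (q : Fin m → Bool) → count (q ∘ quotient {m} n) ≡ n * count q
count-quotient zero    n q = sym (ℕ.*-zeroʳ n)
count-quotient (suc m) n q = begin
  count (q ∘ quotient n)
    ≡⟨ count-cong (cong q ∘ quotient-splitAt {m} n) ⟩
  count (q ∘ [ const zero , suc ∘ quotient {m} n ]′ ∘ splitAt n)
    ≡⟨ count-splitAt n (q ∘ [ const zero , suc ∘ quotient {m} n ]′) ⟩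
  count {n} (const (q zero)) + count (q ∘ suc ∘ quotient {m} n)
    ≡⟨ cong₂ _+_ (count-const n (q zero)) (count-quotient m n (q ∘ suc)) ⟩
  (if q zero then n else 0) + n * count (q ∘ suc)
    ≡⟨ distrib (q zero) (count (q ∘ suc)) ⟩
  n * count q ∎
  where
  open ≡-Reasoning
  distrib : ∀ b c → (if b then n else 0) + n * c ≡ n * (if b then suc c else c)
  distrib true  c = sym (ℕ.*-suc n c)
  distrib false c = refl

-- Stated with does: unlike ⌊_⌋ (= isYes), it reduces through the map′ in suc i ≟ suc j.
count-≟ : ∀ {n} (i : Fin n) → count (λ j → does (i Fin.≟ j)) ≡ 1
count-≟ {suc n} zero    = cong suc (count-const n false)
count-≟ {suc n} (suc i) = count-≟ i

length-filter-tabulate : ∀ {A : Set} {n} (p : A → Bool) (f : Fin n → A) →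
  length (filter (λ x → p x Bool.≟ true) (tabulate f)) ≡ count (p ∘ f)
length-filter-tabulate {n = zero}  p f = refl
length-filter-tabulate {n = suc n} p f with p (f zero)
... | true  = cong suc (length-filter-tabulate p (f ∘ suc))
... | false = length-filter-tabulate p (f ∘ suc)

filter-filter : ∀ {A : Set} (p q : A → Bool) (xs : List A) →
  filter (λ x → p x Bool.≟ true) (filter (λ x → q x Bool.≟ true) xs) ≡
  filter (λ x → q x ∧ p x Bool.≟ true) xs
filter-filter p q []       = refl
filter-filter p q (x ∷ xs) with q x
... | false = filter-filter p q xs
... | true with p x
...   | true  = cong (x ∷_) (filter-filter p q xs)
...   | false = filter-filter p q xs

count-∧-false : ∀ {n} (p : Fin n → Bool) → count (λ i → p i ∧ false) ≡ 0
count-∧-false {n} p = trans (count-cong (∧-zeroʳ ∘ p)) (count-const n false)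

count-∧-true : ∀ {n} (p : Fin n → Bool) → count (λ i → p i ∧ true) ≡ count p
count-∧-true p = count-cong (∧-identityʳ ∘ p)

toℚᵘ-frac : ∀ a b → toℚᵘ (frac a (suc b)) ℚᵘ.≃ ℚᵘ.mkℚᵘ (+ a) b
toℚᵘ-frac a b = ℚ.toℚᵘ-fromℚᵘ (ℚᵘ.mkℚᵘ (+ a) b)

frac-≤-frac : ∀ a b c d → a * suc d ℕ.≤ c * suc b → frac a (suc b) ≤ frac c (suc d)
frac-≤-frac a b c d le = ℚ.toℚᵘ-cancel-≤
  (ℚᵘ.≤-respˡ-≃ (ℚᵘ.≃-sym (toℚᵘ-frac a b)) (ℚᵘ.≤-respʳ-≃ (ℚᵘ.≃-sym (toℚᵘ-frac c d))
    (ℚᵘ.*≤* (subst₂ ℤ._≤_ (ℤ.pos-* a (suc d)) (ℤ.pos-* c (suc b)) (+≤+ le)))))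

frac-<-frac : ∀ a b c d → a * suc d ℕ.< c * suc b → frac a (suc b) < frac c (suc d)
frac-<-frac a b c d lt = ℚ.toℚᵘ-cancel-<
  (ℚᵘ.<-respˡ-≃ (ℚᵘ.≃-sym (toℚᵘ-frac a b)) (ℚᵘ.<-respʳ-≃ (ℚᵘ.≃-sym (toℚᵘ-frac c d))
    (ℚᵘ.*<* (subst₂ ℤ._<_ (ℤ.pos-* a (suc d)) (ℤ.pos-* c (suc b)) (+<+ lt)))))

frac-nonneg : ∀ a b → 0ℚ ≤ frac a b
frac-nonneg a zero    = ℚ.≤-refl
frac-nonneg a (suc b) = frac-≤-frac 0 0 a b ℕ.z≤n

frac-half : ∀ a → frac a (a + a) ≤ ½
frac-half zero    = frac-nonneg 1 2
frac-half (suc a) = frac-≤-frac (suc a) (a + suc a) 1 1 (ℕ.≤-reflexive (twice (suc a)))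
  where
  twice : ∀ a → a * 2 ≡ 1 * (a + a)
  twice = solve-∀

frac-1-antitone : ∀ {a b} → 0 ℕ.< a → a ℕ.< b → frac 1 b < frac 1 a
frac-1-antitone {suc a} {suc b} _ a<b =
  frac-<-frac 1 b 1 a (subst₂ ℕ._<_ (sym (ℕ.*-identityˡ _)) (sym (ℕ.*-identityˡ _)) a<b)

frac-archimedean : ∀ ε → 0ℚ < ε → ∃ λ d → ∀ a b → a * suc d ℕ.< b → frac a b < ε
frac-archimedean (mkℚ -[1+ _ ] _ _) (ℚ.*<* ())
frac-archimedean (mkℚ (+ zero) _ _) (ℚ.*<* (+<+ ()))
frac-archimedean ε@(mkℚ (+ suc p) d _) _ = d , small
  where
  small : ∀ a b → a * suc d ℕ.< b → frac a b < ε
  small a (suc b) lt = subst (frac a (suc b) <_) (ℚ.↥p/↧p≡p ε)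
    (frac-<-frac a b (suc p) d (ℕ.<-≤-trans lt (ℕ.m≤n*m (suc b) (suc p))))

max⁺ : {A : Set} → (A → ℚ) → List A → ℚ
max⁺ f xs = foldr _⊔_ 0ℚ (map f xs)

≤-max⁺ : ∀ {A : Set} (f : A → ℚ) {xs u} → u ∈ xs → f u ≤ max⁺ f xs
≤-max⁺ f {x ∷ xs} (here refl) = ℚ.p≤p⊔q (f x) _
≤-max⁺ f {x ∷ xs} (there u∈xs) = ℚ.≤-trans (≤-max⁺ f u∈xs) (ℚ.p≤q⊔p (f x) _)

max⁺-attained : ∀ {A : Set} (f : A → ℚ) xs →
  max⁺ f xs ≡ 0ℚ ⊎ ∃ λ u → u ∈ xs × f u ≡ max⁺ f xs
max⁺-attained f []       = inj₁ refl
max⁺-attained f (x ∷ xs) with ℚ.⊔-sel (f x) (max⁺ f xs)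
... | inj₁ eq = inj₂ (x , here refl , sym eq)
... | inj₂ eq with max⁺-attained f xs
...   | inj₁ eq′              = inj₁ (trans eq eq′)
...   | inj₂ (u , u∈xs , eq′) = inj₂ (u , there u∈xs , trans eq′ (sym eq))

allB-true : ∀ {A : Set} (p : A → Bool) xs → (∀ u → u ∈ xs → p u ≡ true) → allB p xs ≡ true
allB-true p []       _   = refl
allB-true p (x ∷ xs) all rewrite all x (here refl) = allB-true p xs (λ u → all u ∘ there)

allB-false : ∀ {A : Set} (p : A → Bool) {xs u} → u ∈ xs → p u ≡ false → allB p xs ≡ false
allB-false p {x ∷ xs} (here refl) pu rewrite pu = refl
allB-false p {x ∷ xs} (there u∈xs) pu with p x
... | true  = allB-false p u∈xs pu
... | false = refl

⌊≟⌋-sym : ∀ {m} (i j : Fin m) → ⌊ i Fin.≟ j ⌋ ≡ ⌊ j Fin.≟ i ⌋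
⌊≟⌋-sym i j with i Fin.≟ j | j Fin.≟ i
... | yes _   | yes _   = refl
... | no  _   | no  _   = refl
... | yes i≡j | no  j≢i = ⊥-elim (j≢i (sym i≡j))
... | no  i≢j | yes j≡i = ⊥-elim (i≢j (sym j≡i))

⌊≟⌋-refl : ∀ {m} (i : Fin m) → ⌊ i Fin.≟ i ⌋ ≡ true
⌊≟⌋-refl i = trans (isYes≗does (i Fin.≟ i)) (dec-true (i Fin.≟ i) refl)

⌊≟⌋-≢ : ∀ {m} {i j : Fin m} → i ≢ j → ⌊ i Fin.≟ j ⌋ ≡ false
⌊≟⌋-≢ {i = i} {j} i≢j = trans (isYes≗does (i Fin.≟ j)) (dec-false (i Fin.≟ j) i≢j)

inNbhd : (G : Graph) → Fin (n G) → Fin (n G) → Bool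
inNbhd G v u = ⌊ u Fin.≟ v ⌋ ∨ adj G v u

∈-N : ∀ G {v u} → inNbhd G v u ≡ true → u ∈ N[ G ] v
∈-N G {v} {u} = ∈-filter⁺ (λ u → inNbhd G v u Bool.≟ true) (∈-allFin u)

self-∈-N : ∀ G v → v ∈ N[ G ] v
self-∈-N G v = ∈-N G (cong (_∨ adj G v v) (⌊≟⌋-refl v))

nN-count : ∀ G v → nN G v ≡ count (inNbhd G v)
nN-count G v = length-filter-tabulate (inNbhd G v) id

length-filter-N : ∀ G v (p : Fin (n G) → Bool) →
  length (filter (λ u → p u Bool.≟ true) (N[ G ] v)) ≡ count (λ u → inNbhd G v u ∧ p u)
length-filter-N G v p = trans (cong length (filter-filter p (inNbhd G v) (allFin (n G))))
                              (length-filter-tabulate (λ u → inNbhd G v u ∧ p u) id)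

numD-count : ∀ G c → numD G c ≡ count (isD ∘ c)
numD-count G c = length-filter-tabulate (isD ∘ c) id

power-nonneg : ∀ w G c u → 0ℚ ≤ power w G c u
power-nonneg w G c u with c u | w <? frac (nC G c u) (nN G u)
... | C | yes _ = frac-nonneg 1 (nC G c u)
... | C | no  _ = ℚ.≤-refl
... | D | yes _ = ℚ.≤-refl
... | D | no  _ = frac-nonneg 1 (nD G c u)

power-defector : ∀ w G c v → c v ≡ D → frac (nC G c v) (nN G v) ≤ w →
                 power w G c v ≡ frac 1 (nD G c v)
power-defector w G c v cv≡D losing with c v | w <? frac (nC G c v) (nN G v)
power-defector w G c v refl losing | D | yes winning =
  ⊥-elim (ℚ.<-irrefl refl (ℚ.<-≤-trans winning losing))
power-defector w G c v refl losing | D | no  _       = refl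

power-collaborator : ∀ w G c v → c v ≡ C → power w G c v ≤ frac 1 (nC G c v)
power-collaborator w G c v cv≡C with c v | w <? frac (nC G c v) (nN G v)
power-collaborator w G c v refl | C | yes _ = ℚ.≤-refl
power-collaborator w G c v refl | C | no  _ = frac-nonneg 1 (nC G c v)

≢C⇒≡D : ∀ {s} → s ≢ C → s ≡ D
≢C⇒≡D {C} s≢C = ⊥-elim (s≢C refl)
≢C⇒≡D {D} _   = refl

if-if-D : ∀ {b₁ b₂ s} → b₁ ≡ false → b₂ ≡ true → (if b₁ then C else if b₂ then D else s) ≡ D
if-if-D refl refl = refl

step-≡-D : ∀ w G c v u₀ → u₀ ∈ N[ G ] v →
  (∀ u → u ∈ N[ G ] v → c u ≡ C → power w G c u < power w G c u₀) → step w G c v ≡ D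
step-≡-D w G c v u₀ u₀∈N beaten =
  if-if-D (allB-false _ (proj₂ someMaximiser) notC)
          (allB-true _ maximisers (λ u → cong isD ∘ maximiser-D u))
  where
  P = power w G c
  M = max⁺ P (N[ G ] v)
  maximisers = filter (λ u → P u ℚ.≟ M) (N[ G ] v)

  maximiser-D : ∀ u → u ∈ maximisers → c u ≡ D
  maximiser-D u u∈max with ∈-filter⁻ (λ u → P u ℚ.≟ M) {xs = N[ G ] v} u∈max
  ... | u∈N , Pu≡M =
    ≢C⇒≡D (λ cu → ℚ.<-irrefl Pu≡M (ℚ.<-≤-trans (beaten u u∈N cu) (≤-max⁺ P u₀∈N)))

  someMaximiser : ∃ λ u → u ∈ maximisers
  someMaximiser with max⁺-attained P (N[ G ] v)
  ... | inj₂ (u , u∈N , Pu≡M) = u , ∈-filter⁺ (λ u → P u ℚ.≟ M) u∈N Pu≡M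
  ... | inj₁ M≡0 = u₀ , ∈-filter⁺ (λ u → P u ℚ.≟ M) u₀∈N
      (ℚ.≤-antisym (≤-max⁺ P u₀∈N) (subst (_≤ P u₀) (sym M≡0) (power-nonneg w G c u₀)))

  notC : isC (c (proj₁ someMaximiser)) ≡ false
  notC = cong isC (maximiser-D _ (proj₂ someMaximiser))

dominant-if-step-defects : ∀ w G c → (∀ v → step w G c v ≡ D) → DefectorDominant w G c
dominant-if-step-defects w G c defects = 1 , (λ v → trans (defects v) (sym (stays v))) , defects
  where
  stays : ∀ v → step w G (step w G c) v ≡ D
  stays v = step-≡-D w G (step w G c) v v (self-∈-N G v)
    (λ u _ cu → ⊥-elim (D≢C (trans (sym (defects u)) cu)))
    where
    D≢C : D ≢ C
    D≢C ()

-- The vertex i ↑ˡ k * k (i < k) is a defector and k ↑ʳ u (u < k * k) a collaborator in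
-- block quotient k u; the defectors form a clique, the collaborators form a clique, and each
-- defector is also joined to the k collaborators of its own block.
module Construction (k : ℕ) where

  Role : Set
  Role = Fin k ⊎ Fin (k * k)

  block : Fin (k * k) → Fin k
  block = quotient k

  linked : Role → Role → Bool
  linked (inj₁ _) (inj₁ _) = true
  linked (inj₁ i) (inj₂ u) = does (i Fin.≟ block u)
  linked (inj₂ u) (inj₁ i) = does (i Fin.≟ block u)
  linked (inj₂ _) (inj₂ _) = true

  linked-sym : ∀ r s → linked r s ≡ linked s r
  linked-sym (inj₁ _) (inj₁ _) = refl
  linked-sym (inj₁ _) (inj₂ _) = refl
  linked-sym (inj₂ _) (inj₁ _) = refl
  linked-sym (inj₂ _) (inj₂ _) = refl

  linked-refl : ∀ r → linked r r ≡ true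
  linked-refl (inj₁ _) = refl
  linked-refl (inj₂ _) = refl

  role : Fin (k + k * k) → Role
  role = splitAt k

  graph : Graph
  graph = record
    { n      = k + k * k
    ; adj    = λ u v → not ⌊ u Fin.≟ v ⌋ ∧ linked (role u) (role v)
    ; sym    = λ u v → cong₂ (λ b c → not b ∧ c) (⌊≟⌋-sym u v) (linked-sym (role u) (role v))
    ; irrefl = λ v → cong (λ b → not b ∧ linked (role v) (role v)) (⌊≟⌋-refl v)
    }

  strategy : Role → Strategy
  strategy = [ const D , const C ]′

  initial : Config graph
  initial = strategy ∘ role

  inNbhd-linked : ∀ v u → inNbhd graph v u ≡ linked (role v) (role u)
  inNbhd-linked v u with u Fin.≟ v
  ... | yes refl = sym (linked-refl (role v))
  ... | no  u≢v  = cong (λ b → not b ∧ linked (role v) (role u)) (⌊≟⌋-≢ (u≢v ∘ sym))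

  count-N : ∀ {v r} → role v ≡ r → ∀ (p : Role → Bool) →
    count (λ u → inNbhd graph v u ∧ p (role u)) ≡
    count (λ i → linked r (inj₁ i) ∧ p (inj₁ i)) + count (λ u → linked r (inj₂ u) ∧ p (inj₂ u))
  count-N {v} {r} v↦r p = trans (count-cong in-r) (count-splitAt k (λ s → linked r s ∧ p s))
    where
    in-r : ∀ u → inNbhd graph v u ∧ p (role u) ≡ linked r (role u) ∧ p (role u)
    in-r u = cong (_∧ p (role u)) (trans (inNbhd-linked v u) (cong (λ s → linked s (role u)) v↦r))

  block-size : ∀ i → count (λ u → does (i Fin.≟ block u)) ≡ k
  block-size i = begin
    count (λ u → does (i Fin.≟ block u)) ≡⟨ count-quotient k k (λ j → does (i Fin.≟ j)) ⟩
    k * count (λ j → does (i Fin.≟ j))         ≡⟨ cong (k *_) (count-≟ i) ⟩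
    k * 1                                      ≡⟨ ℕ.*-identityʳ k ⟩
    k                                          ∎
    where open ≡-Reasoning

  nD-defector : ∀ {v i} → role v ≡ inj₁ i → nD graph initial v ≡ k
  nD-defector {v} {i} v↦i = begin
    nD graph initial v
      ≡⟨ length-filter-N graph v (isD ∘ initial) ⟩
    count (λ u → inNbhd graph v u ∧ isD (initial u))
      ≡⟨ count-N v↦i (isD ∘ strategy) ⟩
    count {k} (const true) + count (λ u → does (i Fin.≟ block u) ∧ false)
      ≡⟨ cong₂ _+_ (count-const k true) (count-∧-false (λ u → does (i Fin.≟ block u))) ⟩
    k + 0
      ≡⟨ ℕ.+-identityʳ k ⟩
    k ∎
    where open ≡-Reasoning

  nC-defector : ∀ {v i} → role v ≡ inj₁ i → nC graph initial v ≡ k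
  nC-defector {v} {i} v↦i = begin
    nC graph initial v
      ≡⟨ length-filter-N graph v (isC ∘ initial) ⟩
    count (λ u → inNbhd graph v u ∧ isC (initial u))
      ≡⟨ count-N v↦i (isC ∘ strategy) ⟩
    count {k} (const false) + count (λ u → does (i Fin.≟ block u) ∧ true)
      ≡⟨ cong₂ _+_ (count-const k false) (count-∧-true (λ u → does (i Fin.≟ block u))) ⟩
    count (λ u → does (i Fin.≟ block u))
      ≡⟨ block-size i ⟩
    k ∎
    where open ≡-Reasoning

  nN-defector : ∀ {v i} → role v ≡ inj₁ i → nN graph v ≡ k + k
  nN-defector {v} {i} v↦i = begin
    nN graph v
      ≡⟨ nN-count graph v ⟩
    count (inNbhd graph v)
      ≡⟨ count-∧-true (inNbhd graph v) ⟨
    count (λ u → inNbhd graph v u ∧ true)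
      ≡⟨ count-N v↦i (const true) ⟩
    count {k} (const true) + count (λ u → does (i Fin.≟ block u) ∧ true)
      ≡⟨ cong₂ _+_ (count-const k true)
                   (trans (count-∧-true (λ u → does (i Fin.≟ block u))) (block-size i)) ⟩
    k + k ∎
    where open ≡-Reasoning

  nC-collaborator : ∀ {v u} → role v ≡ inj₂ u → nC graph initial v ≡ k * k
  nC-collaborator {v} {u} v↦u = begin
    nC graph initial v
      ≡⟨ length-filter-N graph v (isC ∘ initial) ⟩
    count (λ u → inNbhd graph v u ∧ isC (initial u))
      ≡⟨ count-N v↦u (isC ∘ strategy) ⟩
    count {k} (λ j → does (j Fin.≟ block u) ∧ false) + count {k * k} (const true)
      ≡⟨ cong₂ _+_ (count-∧-false (λ j → does (j Fin.≟ block u))) (count-const (k * k) true) ⟩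
    k * k ∎
    where open ≡-Reasoning

  numD-initial : numD graph initial ≡ k
  numD-initial = begin
    numD graph initial
      ≡⟨ numD-count graph initial ⟩
    count (isD ∘ strategy ∘ role)
      ≡⟨ count-splitAt k (isD ∘ strategy) ⟩
    count {k} (const true) + count {k * k} (const false)
      ≡⟨ cong₂ _+_ (count-const k true) (count-const (k * k) false) ⟩
    k + 0
      ≡⟨ ℕ.+-identityʳ k ⟩
    k ∎
    where open ≡-Reasoning

  power-defector-initial : ∀ {w} → ½ ≤ w → ∀ {v i} → role v ≡ inj₁ i →
                           power w graph initial v ≡ frac 1 k
  power-defector-initial {w} ½≤w {v} v↦i = begin
    power w graph initial v ≡⟨ power-defector w graph initial v (cong strategy v↦i) losing ⟩
    frac 1 (nD graph initial v) ≡⟨ cong (frac 1) (nD-defector v↦i) ⟩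
    frac 1 k ∎
    where
    open ≡-Reasoning
    losing : frac (nC graph initial v) (nN graph v) ≤ w
    losing rewrite nC-defector v↦i | nN-defector v↦i = ℚ.≤-trans (frac-half k) ½≤w

  collaborator-role : ∀ v → initial v ≡ C → ∃ λ u → role v ≡ inj₂ u
  collaborator-role v v-collab with role v
  ... | inj₂ u = u , refl

  power-collaborator-initial : ∀ w v → initial v ≡ C → power w graph initial v ≤ frac 1 (k * k)
  power-collaborator-initial w v v-collab with collaborator-role v v-collab
  ... | u , v↦u = subst (λ m → power w graph initial v ≤ frac 1 m) (nC-collaborator v↦u)
                        (power-collaborator w graph initial v v-collab)

  defector-beats-collaborators : ∀ {w} → 1 ℕ.< k → ½ ≤ w → ∀ {x i} → role x ≡ inj₁ i →
    ∀ u → initial u ≡ C → power w graph initial u < power w graph initial x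
  defector-beats-collaborators {w} 1<k ½≤w {x} x↦i u u-collab = begin-strict
    power w graph initial u ≤⟨ power-collaborator-initial w u u-collab ⟩
    frac 1 (k * k)          <⟨ frac-1-antitone 0<k (ℕ.m<m*n k k {{ℕ.>-nonZero 0<k}} 1<k) ⟩
    frac 1 k                ≡⟨ power-defector-initial ½≤w x↦i ⟨
    power w graph initial x ∎
    where
    open ℚ.≤-Reasoning
    0<k = ℕ.<⇒≤ 1<k

  owner : Fin (k + k * k) → Fin (k + k * k)
  owner v = [ _↑ˡ (k * k) , (λ u → block u ↑ˡ (k * k)) ]′ (role v)

  owner-role : ∀ v → ∃ λ i → role (owner v) ≡ inj₁ i
  owner-role v with role v
  ... | inj₁ i = i , splitAt-↑ˡ k i (k * k)
  ... | inj₂ u = block u , splitAt-↑ˡ k (block u) (k * k)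

  owner-linked : ∀ v → linked (role v) (role (owner v)) ≡ true
  owner-linked v with role v
  ... | inj₁ i rewrite splitAt-↑ˡ k i (k * k) = refl
  ... | inj₂ u rewrite splitAt-↑ˡ k (block u) (k * k) = dec-true (block u Fin.≟ block u) refl

  step-initial : ∀ {w} → 1 ℕ.< k → ½ ≤ w → ∀ v → step w graph initial v ≡ D
  step-initial {w} 1<k ½≤w v = step-≡-D w graph initial v (owner v)
    (∈-N graph (trans (inNbhd-linked v (owner v)) (owner-linked v)))
    (λ u _ → defector-beats-collaborators 1<k ½≤w (proj₂ (owner-role v)) u)

  initial-dominant : ∀ {w} → 1 ℕ.< k → ½ ≤ w → DefectorDominant w graph initial
  initial-dominant 1<k ½≤w = dominant-if-step-defects _ graph initial (step-initial 1<k ½≤w)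

mainTheorem4 : (ε w : ℚ) → 0ℚ < ε → ½ ≤ w → w < 1ℚ →
    Σ Graph λ G → Σ (Config G) λ c0 →
      NonZero (n G) × frac (numD G c0) (n G) < ε × DefectorDominant w G c0
mainTheorem4 ε w 0<ε ½≤w _ with frac-archimedean ε 0<ε
... | d , below-ε = graph , initial , _ , sparse , initial-dominant 1<k ½≤w
  where
  k = 2 + d
  open Construction k

  1<k : 1 ℕ.< k
  1<k = ℕ.s≤s (ℕ.s≤s ℕ.z≤n)

  sparse : frac (numD graph initial) (n graph) < ε
  sparse = subst (λ m → frac m (n graph) < ε) (sym numD-initial)
    (below-ε k (k + k * k) (ℕ.<-≤-trans (ℕ.*-monoʳ-< k (ℕ.n<1+n (suc d))) (ℕ.m≤n+m (k * k) k)))
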